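{- For every positive integer $n$, $C(n,n)=n-1$.
   Context: The $m\times n$ plane grid has point set $\{0,1,\dots,m\}\times\{0,1,\dots,n\}\subset\mathbb{Z}^2$; it has $2mn$ unit diagonals (two per unit square). The boundary of $[0,m]\times[0,n]$ consists of mirrors. A beam of light travels along unit diagonals from grid point to grid point: at each step each coordinate changes by $\pm1$, and a coordinate reverses its direction of change exactly when it reaches $0$ or its maximum value. The trajectories partition the set of unit diagonals. A trajectory passing through a corner of the rectangle (running from one corner to another) is an open path; every other trajectory is periodic and is called a closed path. $C(m,n)$ denotes the number of closed paths in the $m\times n$ grid. -}

module Defs where

open import Data.Nat using (ℕ; zero; suc; _+_; _*_; _∸_; _≡ᵇ_)
open import Data.Bool using (Bool; true; false; _∨_; if_then_else_)
open import Data.Fin using (Fin; toℕ)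
open import Data.Product using (_×_; _,_; Σ; ∃; ∃-syntax)
open import Data.Sum using (_⊎_)
open import Relation.Nullary using (¬_)
open import Relation.Binary.PropositionalEquality using (_≡_)
open import Relation.Binary.Construct.Closure.Equivalence using (EqClosure)

-- Grid points of the m × n grid are pairs of naturals (x , y), 0 ≤ x ≤ m, 0 ≤ y ≤ n.
Point : Set
Point = ℕ × ℕ

-- A unit diagonal of the m × n grid: the unit square [i,i+1]×[j,j+1]
-- (i : Fin m, j : Fin n) together with a choice of one of its two diagonals.
--   false : from (i , j)     to (i+1 , j+1)
--   true  : from (i+1 , j)   to (i , j+1)
-- There are exactly 2mn of them.
Diagonal : ℕ → ℕ → Set
Diagonal m n = Fin m × Fin n × Bool

ends : ∀ {m n} → Diagonal m n → Point × Point
ends (i , j , false) = (toℕ i , toℕ j) , (suc (toℕ i) , suc (toℕ j))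
ends (i , j , true)  = (suc (toℕ i) , toℕ j) , (toℕ i , suc (toℕ j))

HasEnds : ∀ {m n} → Diagonal m n → Point → Point → Set
HasEnds d p a = (ends d ≡ (p , a)) ⊎ (ends d ≡ (a , p))

-- Mirror law for one coordinate with maximum M: the beam arrived at coordinate p
-- coming from coordinate a (= p ± 1).
bounce : ℕ → ℕ → ℕ → ℕ
bounce M p a = if (p ≡ᵇ 0) ∨ (p ≡ᵇ M) then a else (2 * p) ∸ a

bounceP : ℕ → ℕ → Point → Point → Point
bounceP m n (px , py) (ax , ay) = bounce m px ax , bounce n py ay

-- e follows d along a light beam: the beam traverses d from a to p and then
-- traverses e from p to the reflected/continued point.
Next : ∀ {m n} → Diagonal m n → Diagonal m n → Set
Next {m} {n} d e = ∃[ p ] ∃[ a ] (HasEnds d p a × HasEnds e p (bounceP m n p a))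

SameTrajectory : ∀ {m n} → Diagonal m n → Diagonal m n → Set
SameTrajectory {m} {n} = EqClosure (Next {m} {n})

IsCorner : ℕ → ℕ → Point → Set
IsCorner m n (x , y) = (x ≡ 0 ⊎ x ≡ m) × (y ≡ 0 ⊎ y ≡ n)

CornerDiagonal : ∀ {m n} → Diagonal m n → Set
CornerDiagonal {m} {n} d = ∃[ p ] ∃[ a ] (HasEnds d p a × IsCorner m n p)

OnClosedPath : ∀ {m n} → Diagonal m n → Set
OnClosedPath {m} {n} d = ∀ (e : Diagonal m n) → SameTrajectory d e → ¬ CornerDiagonal e

-- C(m,n) = k : there are exactly k closed paths, i.e. the closed-path diagonals
-- fall into exactly k trajectory classes (given by k pairwise inequivalent representatives
-- covering all of them).
ClosedPathCount : ℕ → ℕ → ℕ → Set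
ClosedPathCount m n k =
  Σ (Fin k → Diagonal m n) λ rep →
    (∀ i → OnClosedPath (rep i)) ×
    (∀ (d : Diagonal m n) → OnClosedPath d → ∃[ i ] SameTrajectory d (rep i)) ×
    (∀ i j → SameTrajectory (rep i) (rep j) → i ≡ j)

-- Unfolding the mirrors, a beam runs along lines x − y = c or x + y = c, and a reflection
-- only replaces c by −c modulo 2n; so the index of the line, c ∈ [0, n] up to sign, is
-- constant along a trajectory.  The slope changes only where exactly one coordinate
-- reflects, i.e. on the boundary, where both lines through a point have the same index.
-- Corner diagonals have index 0 or n, and the rising diagonal from (k, 0) has index k, so
-- for 1 ≤ k ≤ n − 1 these lie on n − 1 distinct closed paths.  Conversely, following any
-- beam downwards row by row, a closed path meets the bottom row in one of them.
module Submission where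

open import Defs
open import Data.Nat using (ℕ; zero; suc; _+_; _*_; _∸_; _≡ᵇ_; _≤_; _<_; _≥_; _⊓_; ∣_-_∣; z<s; s<s; s<s⁻¹)
open import Data.Nat.Properties
open import Data.Bool using (Bool; true; false; not; _xor_)
open import Data.Bool.Properties using (∨-zeroʳ; T-≡; xor-annihilates-not)
open import Data.Empty using (⊥-elim)
open import Data.Fin using (Fin; toℕ; fromℕ<; zero; suc)
open import Data.Fin.Properties using (toℕ<n; toℕ-fromℕ<; fromℕ<-toℕ; toℕ-injective)
open import Data.Product using (_×_; _,_; Σ; ∃-syntax; proj₁; proj₂; map₂)
open import Data.Sum using (_⊎_; inj₁; inj₂)
open import Function.Bundles using (Equivalence)
open import Relation.Binary.PropositionalEquality
open import Relation.Binary.Construct.Closure.Equivalence using (gfold; return)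
open import Relation.Binary.Construct.Closure.ReflexiveTransitive using (ε; _◅◅_)

bounce-max : ∀ M a → bounce M M a ≡ a
bounce-max M a rewrite Equivalence.to T-≡ (≡⇒≡ᵇ M M refl) | ∨-zeroʳ (M ≡ᵇ 0) = refl

bounce-inner : ∀ {M x} a → suc x < M → bounce M (suc x) a ≡ 2 * suc x ∸ a
bounce-inner {M} {x} a x<M with suc x ≡ᵇ M in eq
... | true  = ⊥-elim (<⇒≢ x<M (≡ᵇ⇒≡ (suc x) M (Equivalence.from T-≡ eq)))
... | false = refl

bounce-inner-up : ∀ {M x} → suc x < M → bounce M (suc x) x ≡ suc (suc x)
bounce-inner-up {x = x} x<M rewrite bounce-inner x x<M | +-identityʳ x | +-suc x x =
  m+n∸n≡m (suc (suc x)) x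

bounce-inner-down : ∀ {M x} → suc x < M → bounce M (suc x) (suc (suc x)) ≡ x
bounce-inner-down {x = x} x<M rewrite bounce-inner (suc (suc x)) x<M | +-identityʳ x | +-suc x x =
  m+n∸m≡n x x

data Step : ℕ → ℕ → Set where
  up   : ∀ {x} → Step x (suc x)
  down : ∀ {x} → Step (suc x) x

rising : ∀ {x y} → Step x y → Bool
rising up   = true
rising down = false

rising-bounce-inner : ∀ {M p a} → 0 < p → p < M → (s : Step p a) (t : Step p (bounce M p a)) →
                      rising t ≡ not (rising s)
rising-bounce-inner {M} {suc x} _ x<M up t
  with bounce M (suc x) (suc (suc x)) | bounce-inner-down x<M | t
... | _ | refl | down = refl
rising-bounce-inner {M} {suc x} _ x<M down t
  with bounce M (suc x) x | bounce-inner-up x<M | t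
... | _ | refl | up = refl

wall-or-inner : ∀ {M x} → x ≤ M → (x ≡ 0 ⊎ x ≡ M) ⊎ (0 < x × x < M)
wall-or-inner {x = zero}  _ = inj₁ (inj₁ refl)
wall-or-inner {x = suc x} x≤M with m≤n⇒m<n∨m≡n x≤M
... | inj₁ x<M = inj₂ (z<s , x<M)
... | inj₂ x≡M = inj₁ (inj₂ x≡M)

OnBoundary : ℕ → Point → Set
OnBoundary n (x , y) = (x ≡ 0 ⊎ x ≡ n) ⊎ (y ≡ 0 ⊎ y ≡ n)

InGrid : ℕ → Point → Set
InGrid n (x , y) = x ≤ n × y ≤ n

-- The c ∈ [0, n] with x − y ≡ ±c (slope false) or x + y ≡ ±c (slope true) modulo 2n.
lineIndex : ℕ → Bool → Point → ℕ
lineIndex n false (x , y) = ∣ x - y ∣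
lineIndex n true  (x , y) = (x + y) ⊓ (n + n ∸ (x + y))

min-mirror-low : ∀ {n y} → y ≤ n → y ⊓ (n + n ∸ y) ≡ y
min-mirror-low {n} {y} y≤n = m≤n⇒m⊓n≡m (begin
  y             ≤⟨ y≤n ⟩
  n             ≡⟨ m+n∸n≡m n n ⟨
  n + n ∸ n     ≤⟨ ∸-monoʳ-≤ (n + n) y≤n ⟩
  n + n ∸ y     ∎)
  where open ≤-Reasoning

min-mirror-high : ∀ {n y} → y ≤ n → (n + y) ⊓ (n + n ∸ (n + y)) ≡ n ∸ y
min-mirror-high {n} {y} y≤n rewrite [m+n]∸[m+o]≡n∸o n n y =
  m≥n⇒m⊓n≡n (≤-trans (m∸n≤m n y) (m≤m+n n y))

lineIndex-on-boundary : ∀ {n p} → InGrid n p → OnBoundary n p → ∀ b → lineIndex n b p ≡ lineIndex n false p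
lineIndex-on-boundary _ _ false = refl
lineIndex-on-boundary {n} {x , y} (x≤n , y≤n) (inj₁ (inj₁ refl)) true = min-mirror-low y≤n
lineIndex-on-boundary {n} {x , y} (x≤n , y≤n) (inj₁ (inj₂ refl)) true =
  trans (min-mirror-high y≤n) (sym (m≤n⇒∣n-m∣≡n∸m y≤n))
lineIndex-on-boundary {n} {x , y} (x≤n , y≤n) (inj₂ (inj₁ refl)) true
  rewrite +-identityʳ x = trans (min-mirror-low x≤n) (sym (∣-∣-identityʳ x))
lineIndex-on-boundary {n} {x , y} (x≤n , y≤n) (inj₂ (inj₂ refl)) true
  rewrite +-comm x n = trans (min-mirror-high x≤n) (sym (m≤n⇒∣m-n∣≡n∸m x≤n))

lineIndex-corner : ∀ {n p} → IsCorner n n p → lineIndex n false p ≡ 0 ⊎ lineIndex n false p ≡ n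
lineIndex-corner {n} (inj₁ refl , inj₁ refl) = inj₁ refl
lineIndex-corner {n} (inj₁ refl , inj₂ refl) = inj₂ refl
lineIndex-corner {n} (inj₂ refl , inj₁ refl) = inj₂ (∣-∣-identityʳ n)
lineIndex-corner {n} (inj₂ refl , inj₂ refl) = inj₁ (∣n-n∣≡0 n)

module _ {n : ℕ} where

  slope : Diagonal n n → Bool
  slope (_ , _ , b) = b

  index : Diagonal n n → ℕ
  index d = lineIndex n (slope d) (proj₁ (ends d))

  index-at-end : ∀ {d : Diagonal n n} {p a} → HasEnds d p a → index d ≡ lineIndex n (slope d) p
  index-at-end {_ , _ , false} (inj₁ refl) = refl
  index-at-end {_ , _ , false} (inj₂ refl) = refl
  index-at-end {_ , _ , true}  (inj₁ refl) = refl
  index-at-end {i , j , true}  (inj₂ refl) =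
    cong (λ s → s ⊓ (n + n ∸ s)) (sym (+-suc (toℕ i) (toℕ j)))

  end-in-grid : ∀ {d : Diagonal n n} {p a} → HasEnds d p a → InGrid n p
  end-in-grid {i , j , false} (inj₁ refl) = <⇒≤ (toℕ<n i) , <⇒≤ (toℕ<n j)
  end-in-grid {i , j , false} (inj₂ refl) = toℕ<n i , toℕ<n j
  end-in-grid {i , j , true}  (inj₁ refl) = toℕ<n i , <⇒≤ (toℕ<n j)
  end-in-grid {i , j , true}  (inj₂ refl) = <⇒≤ (toℕ<n i) , toℕ<n j

  slope-steps : ∀ {d : Diagonal n n} {p a} → HasEnds d p a →
                Σ (Step (proj₁ p) (proj₁ a)) λ sx → Σ (Step (proj₂ p) (proj₂ a)) λ sy →
                  slope d ≡ rising sx xor rising sy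
  slope-steps {_ , _ , false} (inj₁ refl) = up , up , refl
  slope-steps {_ , _ , false} (inj₂ refl) = down , down , refl
  slope-steps {_ , _ , true}  (inj₁ refl) = down , up , refl
  slope-steps {_ , _ , true}  (inj₂ refl) = up , down , refl

  slope-kept-inside : ∀ {d e : Diagonal n n} {x y a} → HasEnds d (x , y) a → HasEnds e (x , y) (bounceP n n (x , y) a) →
                      0 < x × x < n → 0 < y × y < n → slope d ≡ slope e
  slope-kept-inside {d} {e} hd he (0<x , x<n) (0<y , y<n)
    with slope-steps hd | slope-steps he
  ... | sx , sy , slope-d | tx , ty , slope-e = begin
    slope d                             ≡⟨ slope-d ⟩
    rising sx xor rising sy             ≡⟨ xor-annihilates-not (rising sx) (rising sy) ⟨
    not (rising sx) xor not (rising sy) ≡⟨ cong₂ _xor_ (rising-bounce-inner 0<x x<n sx tx)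
                                                       (rising-bounce-inner 0<y y<n sy ty) ⟨
    rising tx xor rising ty             ≡⟨ slope-e ⟨
    slope e                             ∎
    where open ≡-Reasoning

  index-next : ∀ {d e : Diagonal n n} → Next d e → index d ≡ index e
  index-next {d} {e} ((x , y) , a , hd , he) = begin
    index d                        ≡⟨ index-at-end hd ⟩
    lineIndex n (slope d) (x , y)  ≡⟨ same-line ⟩
    lineIndex n (slope e) (x , y)  ≡⟨ index-at-end he ⟨
    index e                        ∎
    where
    open ≡-Reasoning
    in-grid : InGrid n (x , y)
    in-grid = end-in-grid hd
    same-line-on-boundary : OnBoundary n (x , y) → lineIndex n (slope d) (x , y) ≡ lineIndex n (slope e) (x , y)
    same-line-on-boundary onB = trans (lineIndex-on-boundary in-grid onB (slope d))
                                      (sym (lineIndex-on-boundary in-grid onB (slope e)))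
    same-line : lineIndex n (slope d) (x , y) ≡ lineIndex n (slope e) (x , y)
    same-line with wall-or-inner (proj₁ in-grid) | wall-or-inner (proj₂ in-grid)
    ... | inj₁ wall-x  | _            = same-line-on-boundary (inj₁ wall-x)
    ... | inj₂ _       | inj₁ wall-y  = same-line-on-boundary (inj₂ wall-y)
    ... | inj₂ inner-x | inj₂ inner-y = cong (λ b → lineIndex n b (x , y)) (slope-kept-inside hd he inner-x inner-y)

  index-trajectory : ∀ {d e : Diagonal n n} → SameTrajectory d e → index d ≡ index e
  index-trajectory = gfold isEquivalence index index-next

  index-corner : ∀ {d : Diagonal n n} → CornerDiagonal d → index d ≡ 0 ⊎ index d ≡ n
  index-corner {d} (p , a , hd , corner) rewrite index-at-end hd
    | lineIndex-on-boundary (end-in-grid hd) (inj₁ (proj₁ corner)) (slope d) = lineIndex-corner corner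

  diag : ∀ x y → .(x < n) → .(y < n) → Bool → Diagonal n n
  diag x y x<n y<n b = fromℕ< x<n , fromℕ< y<n , b

  diag-toℕ : ∀ (i j : Fin n) b → diag (toℕ i) (toℕ j) (toℕ<n i) (toℕ<n j) b ≡ (i , j , b)
  diag-toℕ i j b rewrite fromℕ<-toℕ i (toℕ<n i) | fromℕ<-toℕ j (toℕ<n j) = refl

  ends-diag-rising : ∀ {x y} .(x<n : x < n) .(y<n : y < n) →
                     ends (diag x y x<n y<n false) ≡ ((x , y) , (suc x , suc y))
  ends-diag-rising x<n y<n rewrite toℕ-fromℕ< x<n | toℕ-fromℕ< y<n = refl

  ends-diag-falling : ∀ {x y} .(x<n : x < n) .(y<n : y < n) →
                      ends (diag x y x<n y<n true) ≡ ((suc x , y) , (x , suc y))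
  ends-diag-falling x<n y<n rewrite toℕ-fromℕ< x<n | toℕ-fromℕ< y<n = refl

  closed-along : ∀ {d e : Diagonal n n} → SameTrajectory d e → OnClosedPath d → OnClosedPath e
  closed-along d~e closed-d f e~f = closed-d f (d~e ◅◅ e~f)

module _ {m : ℕ} where

  rep : Fin m → Diagonal (suc m) (suc m)
  rep k = suc k , zero , false

  rep-closed : ∀ k → OnClosedPath (rep k)
  rep-closed k e rep~e corner with index-corner corner
  ... | inj₁ index≡0 = 0≢1+n (sym (trans (index-trajectory rep~e) index≡0))
  ... | inj₂ index≡n = <-irrefl (suc-injective (trans (index-trajectory rep~e) index≡n)) (toℕ<n k)

  rep-distinct : ∀ k l → SameTrajectory (rep k) (rep l) → k ≡ l
  rep-distinct k l k~l = toℕ-injective (suc-injective (index-trajectory k~l))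

  ReachesRep : Diagonal (suc m) (suc m) → Set
  ReachesRep d = ∃[ k ] SameTrajectory d (rep k)

  beam-step : ∀ {d e x y ax ay qx qy} → HasEnds d (x , y) (ax , ay) → HasEnds e (x , y) (qx , qy) →
              bounce (suc m) x ax ≡ qx → bounce (suc m) y ay ≡ qy →
              OnClosedPath d → (OnClosedPath e → ReachesRep e) → ReachesRep d
  beam-step hd he refl refl closed-d reach-e =
    map₂ (return d→e ◅◅_) (reach-e (closed-along (return d→e) closed-d))
    where d→e = _ , _ , hd , he

  diag-reaches-rep : ∀ x y (x<n : x < suc m) (y<n : y < suc m) b →
                     OnClosedPath (diag x y x<n y<n b) → ReachesRep (diag x y x<n y<n b)
  diag-reaches-rep zero zero _ _ false closed =
    ⊥-elim (closed _ ε (_ , _ , inj₁ refl , inj₁ refl , inj₁ refl))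
  diag-reaches-rep (suc x) zero x<n _ false _ = fromℕ< (s<s⁻¹ x<n) , ε
  diag-reaches-rep x zero x<n y<n true closed with m≤n⇒m<n∨m≡n (m<1+n⇒m≤n x<n)
  ... | inj₁ x<m =
    beam-step (inj₁ (ends-diag-falling x<n y<n)) (inj₁ (ends-diag-rising (s<s x<m) y<n))
              (bounce-inner-up (s<s x<m)) refl
              closed (λ _ → fromℕ< x<m , ε)
  ... | inj₂ refl =
    ⊥-elim (closed _ ε (_ , _ , inj₁ (ends-diag-falling x<n y<n) , inj₂ refl , inj₁ refl))
  diag-reaches-rep zero (suc y) x<n y<n false closed =
    beam-step (inj₁ (ends-diag-rising x<n y<n)) (inj₂ (ends-diag-falling x<n y<n′))
              refl (bounce-inner-down y<n)
              closed (diag-reaches-rep 0 y x<n y<n′ true)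
    where y<n′ = m<n⇒m<1+n (s<s⁻¹ y<n)
  diag-reaches-rep (suc x) (suc y) x<n y<n false closed =
    beam-step (inj₁ (ends-diag-rising x<n y<n)) (inj₂ (ends-diag-rising x<n′ y<n′))
              (bounce-inner-down x<n) (bounce-inner-down y<n)
              closed (diag-reaches-rep x y x<n′ y<n′ false)
    where x<n′ = m<n⇒m<1+n (s<s⁻¹ x<n)
          y<n′ = m<n⇒m<1+n (s<s⁻¹ y<n)
  diag-reaches-rep x (suc y) x<n y<n true closed with m≤n⇒m<n∨m≡n (m<1+n⇒m≤n x<n)
  ... | inj₁ x<m =
    beam-step (inj₁ (ends-diag-falling x<n y<n)) (inj₂ (ends-diag-falling (s<s x<m) y<n′))
              (bounce-inner-up (s<s x<m)) (bounce-inner-down y<n)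
              closed (diag-reaches-rep (suc x) y (s<s x<m) y<n′ true)
    where y<n′ = m<n⇒m<1+n (s<s⁻¹ y<n)
  ... | inj₂ refl =
    beam-step (inj₁ (ends-diag-falling x<n y<n)) (inj₂ (ends-diag-rising x<n y<n′))
              (bounce-max (suc m) m) (bounce-inner-down y<n)
              closed (diag-reaches-rep m y x<n y<n′ false)
    where y<n′ = m<n⇒m<1+n (s<s⁻¹ y<n)

  closed-reaches-rep : ∀ d → OnClosedPath d → ReachesRep d
  closed-reaches-rep (i , j , b) = subst (λ d → OnClosedPath d → ReachesRep d) (diag-toℕ i j b)
    (diag-reaches-rep (toℕ i) (toℕ j) (toℕ<n i) (toℕ<n j) b)

lemma2p1 : (n : ℕ) → n ≥ 1 → ClosedPathCount n n (n ∸ 1)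
lemma2p1 (suc m) _ = rep , rep-closed , closed-reaches-rep , rep-distinct
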